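{- For every $n$ and every search sequence $X = x_1,\ldots,x_m$ over $\{1,\ldots,n\}$, $$\min_T R_r(T,X) = \Omega\Big(\min_T R_\ell(T,X)\Big) = \Omega(OPT(X)),$$ where the minima range over all static BSTs $T$ on $\{1,\ldots,n\}$. Furthermore, there exist classes of search sequences of any length $m$, denoted $X^1_m$ and $X^2_m$, such that $$\min_T R_r(T,X^1_m) = \omega\Big(\min_T R_\ell(T,X^1_m)\Big) \quad\text{and}\quad \min_T R_\ell(T,X^2_m) = \omega(OPT(X^2_m)).$$
   Context: A static BST $T$ stores keys $1,\ldots,n$ and is never modified. $d_T(v)$ is the depth of $v$ (root has depth $0$), $\mathrm{LCA}_T(i,j)$ the lowest common ancestor, and $r(T,i,j) = d_T(i)+d_T(j)-2d_T(\mathrm{LCA}_T(i,j))$. For a search sequence $X = x_1,\ldots,x_m$: the root finger cost is $R_r(T,X) = \sum_{i=1}^m d_T(x_i)$ (each search starts at the root), and the lazy finger cost is $R_\ell(T,X) = \sum_{i=1}^m r(T,x_{i-1},x_i)$ with $x_0$ the root of $T$ (each search starts where the previous one ended). $OPT(X)$ denotes the minimum cost with which any binary search tree allowing rotations (the standard dynamic BST model: a single pointer starting at the root for each search, unit cost per pointer move and per rotation) can execute $X$. The asymptotic notations are with respect to $n$ (and $m$) growing. -}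

module Defs where

open import Data.Nat using (ℕ; zero; suc; _+_; _*_; _∸_; _≤_; _<_; _<ᵇ_)
open import Data.Bool using (Bool; true; false; if_then_else_; _∧_)
open import Data.List using (List; []; _∷_; _++_; map; upTo; length)
open import Data.Nat.ListAction using (sum)
open import Data.List.Relation.Unary.All using (All)
open import Data.Product using (_×_)
open import Relation.Binary.PropositionalEquality using (_≡_)

data Tree : Set where
  leaf : Tree
  node : Tree → ℕ → Tree → Tree

inorder : Tree → List ℕ
inorder leaf         = []
inorder (node l k r) = inorder l ++ (k ∷ inorder r)

IsBST : ℕ → Tree → Set
IsBST n T = inorder T ≡ map suc (upTo n)

ValidSeq : ℕ → List ℕ → Set
ValidSeq n X = All (λ x → (1 ≤ x) × (x ≤ n)) X

depth : Tree → ℕ → ℕ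
depth leaf x = 0
depth (node l k r) x =
  if x <ᵇ k then suc (depth l x)
  else if k <ᵇ x then suc (depth r x)
  else 0

lca : Tree → ℕ → ℕ → ℕ
lca leaf i j = 0
lca (node l k r) i j =
  if (i <ᵇ k) ∧ (j <ᵇ k) then lca l i j
  else if (k <ᵇ i) ∧ (k <ᵇ j) then lca r i j
  else k

dist : Tree → ℕ → ℕ → ℕ
dist T i j = (depth T i + depth T j) ∸ (2 * depth T (lca T i j))

rootKey : Tree → ℕ
rootKey leaf         = 0
rootKey (node _ k _) = k

Rr : Tree → List ℕ → ℕ
Rr T X = sum (map (depth T) X)

lazyFrom : Tree → ℕ → List ℕ → ℕ
lazyFrom T p []       = 0
lazyFrom T p (x ∷ xs) = dist T p x + lazyFrom T x xs

Rℓ : Tree → List ℕ → ℕ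
Rℓ T X = lazyFrom T (rootKey T) X

-- zipper context: position of the pointer inside the tree
data Ctx : Set where
  top     : Ctx
  leftOf  : Ctx → ℕ → Tree → Ctx
  rightOf : Tree → ℕ → Ctx → Ctx

plug : Ctx → Tree → Tree
plug top             t = t
plug (leftOf c k r)  t = plug c (node t k r)
plug (rightOf l k c) t = plug c (node l k t)

data Step : Ctx → Tree → Ctx → Tree → Set where
  goLeft  : ∀ {c l k r} → Step c (node l k r) (leftOf c k r) l
  goRight : ∀ {c l k r} → Step c (node l k r) (rightOf l k c) r
  goUpL   : ∀ {c k r t} → Step (leftOf c k r) t c (node t k r)
  goUpR   : ∀ {c l k t} → Step (rightOf l k c) t c (node l k t)
  rotL    : ∀ {c y r a x b} →
            Step (leftOf c y r) (node a x b) c (node a x (node b y r))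
  rotR    : ∀ {c l y a x b} →
            Step (rightOf l y c) (node a x b) c (node (node l y a) x b)

data Steps : Ctx → Tree → Ctx → Tree → ℕ → Set where
  done : ∀ {c t} → Steps c t c t 0
  more : ∀ {c t c' t' c'' t'' k} →
         Step c t c' t' → Steps c' t' c'' t'' k → Steps c t c'' t'' (suc k)

-- searching x in tree t: pointer starts at the root, must reach x,
-- may continue working; result tree t', total cost `cost`
data Search (t : Tree) (x : ℕ) (t' : Tree) (cost : ℕ) : Set where
  search : ∀ {c₁ l₁ r₁ c₂ f₂ a b} →
           Steps top t c₁ (node l₁ x r₁) a →
           Steps c₁ (node l₁ x r₁) c₂ f₂ b →
           plug c₂ f₂ ≡ t' →
           a + b ≡ cost →
           Search t x t' cost

data Executes : Tree → List ℕ → ℕ → Set where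
  finish : ∀ {t} → Executes t [] 0
  next   : ∀ {t x t' xs a b} →
           Search t x t' a → Executes t' xs b → Executes t (x ∷ xs) (a + b)

record SeqFamily : Set where
  field
    size  : ℕ → ℕ
    seq   : ℕ → List ℕ
    len   : ∀ m → length (seq m) ≡ m
    valid : ∀ m → ValidSeq (size m) (seq m)
open SeqFamily public

-- A lazy-finger move from p to x climbs to lca(p, x) and descends again, so it costs at most
-- d(p) + d(x); summing over the sequence gives R_ℓ ≤ 2 R_r.  For the dynamic bound, keep the
-- static tree with the finger's node rotated up to the root: one finger move along an edge of T
-- changes that tree by at most two rotations, so a lazy-finger walk of length r is executed
-- with at most 6 r operations.  For the separations: on 1^⌊m/2⌋ 2^⌈m/2⌉ the lazy finger pays 1
-- on the tree 1 → 2 while every static tree pays ⌊m/2⌋ at the root; on 1, 2, 1, 3, 1, 4, … a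
-- dynamic tree keeping 1 at the root and the next key as its right child pays 3 per round,
-- while in a static tree fewer than 2^(1+D) keys lie within distance D of key 1, so for every D
-- the lazy finger pays about D per round.

module Submission where

open import Defs
open import Data.Bool using (Bool; true; false; if_then_else_; T)
open import Data.Bool.Properties using (∧-zeroʳ)
open import Data.Empty using (⊥-elim)
open import Data.List using (List; []; _∷_; _++_; map; upTo; applyUpTo; length; replicate)
open import Data.List.Properties
  using (map-applyUpTo; ∷-injective; map-++; length-++; length-replicate; ++-identityʳ; ++-assoc)
open import Data.List.Relation.Unary.All as All using (All; []; _∷_)
open import Data.List.Relation.Unary.All.Properties using (++⁺; replicate⁺)
open import Data.Nat
open import Data.Nat.Properties
open import Data.Nat.ListAction using (sum)
open import Data.Nat.ListAction.Properties using (sum-++)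
open import Data.Nat.Solver using (module +-*-Solver)
open +-*-Solver using (solve; _:+_; _:*_; _:=_; con)
open import Data.Product using (Σ-syntax; _×_; _,_; proj₁; proj₂)
open import Data.Sum using (_⊎_; inj₁; inj₂)
open import Function using (_∘_; id)
open import Relation.Binary using (tri<; tri≈; tri>)
open import Relation.Binary.PropositionalEquality
open import Relation.Nullary using (yes; no)

private variable
  a b k p x : ℕ
  l r t : Tree

<⇒<ᵇ≡true : ∀ {m n} → m < n → (m <ᵇ n) ≡ true
<⇒<ᵇ≡true {m} {n} m<n with m <ᵇ n | <⇒<ᵇ m<n
... | true | _ = refl

≤⇒<ᵇ≡false : ∀ {m n} → n ≤ m → (m <ᵇ n) ≡ false
≤⇒<ᵇ≡false {m} {n} n≤m with m <ᵇ n | <ᵇ⇒< m n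
... | false | _   = refl
... | true  | m<n = ⊥-elim (<⇒≱ (m<n _) n≤m)

<ᵇ≡false⇒≥ : ∀ {m n} → (m <ᵇ n) ≡ false → n ≤ m
<ᵇ≡false⇒≥ eq = ≮⇒≥ (λ m<n → subst T eq (<⇒<ᵇ m<n))

depth-node-< : x < k → depth (node l k r) x ≡ suc (depth l x)
depth-node-< x<k rewrite <⇒<ᵇ≡true x<k = refl

depth-node-> : k < x → depth (node l k r) x ≡ suc (depth r x)
depth-node-> k<x rewrite ≤⇒<ᵇ≡false (<⇒≤ k<x) | <⇒<ᵇ≡true k<x = refl

depth-node-root : depth (node l k r) k ≡ 0
depth-node-root {k = k} rewrite ≤⇒<ᵇ≡false (≤-refl {k}) = refl

depth-node-≥ : ∀ {u} → k ≤ x → depth (node l k r) x ≡ depth (node u k r) x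
depth-node-≥ k≤x rewrite ≤⇒<ᵇ≡false k≤x = refl

depth-node-≤ : ∀ {u} → x ≤ k → depth (node l k r) x ≡ depth (node l k u) x
depth-node-≤ x≤k rewrite ≤⇒<ᵇ≡false x≤k = refl

depth≡0⇒root : depth (node l k r) x ≡ 0 → x ≡ k
depth≡0⇒root {l} {k} {r} {x} _ with x <ᵇ k in x≮k | k <ᵇ x in k≮x
... | false | false = ≤-antisym (<ᵇ≡false⇒≥ k≮x) (<ᵇ≡false⇒≥ x≮k)

lca-node-< : p < k → x < k → lca (node l k r) p x ≡ lca l p x
lca-node-< p<k x<k rewrite <⇒<ᵇ≡true p<k | <⇒<ᵇ≡true x<k = refl

lca-node-> : k < p → k < x → lca (node l k r) p x ≡ lca r p x
lca-node-> k<p k<x rewrite ≤⇒<ᵇ≡false (<⇒≤ k<p) | <⇒<ᵇ≡true k<p | <⇒<ᵇ≡true k<x = refl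

lca-node-≤≤ : p ≤ k → k ≤ x → lca (node l k r) p x ≡ k
lca-node-≤≤ {p} {k} p≤k k≤x
  rewrite ≤⇒<ᵇ≡false k≤x | ∧-zeroʳ (p <ᵇ k) | ≤⇒<ᵇ≡false p≤k = refl

lca-node-≥≥ : k ≤ p → x ≤ k → lca (node l k r) p x ≡ k
lca-node-≥≥ {k} {p} k≤p x≤k
  rewrite ≤⇒<ᵇ≡false k≤p | ≤⇒<ᵇ≡false x≤k | ∧-zeroʳ (k <ᵇ p) = refl

lca-node-root : lca (node l k r) k x ≡ k
lca-node-root {k = k} rewrite ≤⇒<ᵇ≡false (≤-refl {k}) = refl

data Side (k p x : ℕ) : Set where
  left   : p < k → x < k → Side k p x
  right  : k < p → k < x → Side k p x
  across : (∀ {l r} → lca (node l k r) p x ≡ k) → Side k p x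

side : ∀ k p x → Side k p x
side k p x with <-cmp p k
... | tri≈ _ refl _ = across λ {l r} → lca-node-root {l = l} {r = r}
... | tri< p<k _ _ with x <? k
...   | yes x<k = left p<k x<k
...   | no  x≮k = across λ {l r} → lca-node-≤≤ {l = l} {r = r} (<⇒≤ p<k) (≮⇒≥ x≮k)
side k p x | tri> _ _ k<p with k <? x
...   | yes k<x = right k<p k<x
...   | no  k≮x = across λ {l r} → lca-node-≥≥ {l = l} {r = r} (<⇒≤ k<p) (≮⇒≥ k≮x)

dist-node-across : lca (node l k r) p x ≡ k →
  dist (node l k r) p x ≡ depth (node l k r) p + depth (node l k r) x
dist-node-across {l} {k} {r} lca≡k rewrite lca≡k | depth-node-root {l} {k} {r} = refl

-- Search trees on an interval of keys

-- BST a b t: the in-order traversal of t is a, a + 1, …, b − 1.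
data BST : ℕ → ℕ → Tree → Set where
  leaf : BST a a leaf
  node : BST a k l → BST (suc k) b r → BST a b (node l k r)

range : ℕ → ℕ → List ℕ
range a zero    = []
range a (suc s) = a ∷ range (suc a) s

length-range : ∀ a s → length (range a s) ≡ s
length-range a zero    = refl
length-range a (suc s) = cong suc (length-range (suc a) s)

applyUpTo≗range : ∀ {f : ℕ → ℕ} s → (∀ i → f i ≡ a + i) → applyUpTo f s ≡ range a s
applyUpTo≗range {a} zero    f≗ = refl
applyUpTo≗range {a} (suc s) f≗ = cong₂ _∷_
  (trans (f≗ 0) (+-identityʳ a))
  (applyUpTo≗range s (λ i → trans (f≗ (suc i)) (+-suc a i)))

map-suc-upTo : ∀ n → map suc (upTo n) ≡ range 1 n
map-suc-upTo n = trans (map-applyUpTo id suc n) (applyUpTo≗range n (λ _ → refl))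

range-split : ∀ xs {y ys} s → xs ++ y ∷ ys ≡ range a s →
  Σ[ s₁ ∈ ℕ ] Σ[ s₂ ∈ ℕ ]
    xs ≡ range a s₁ × y ≡ a + s₁ × ys ≡ range (suc y) s₂ × a + s ≡ suc y + s₂
range-split {a} []       (suc s) refl = 0 , s , refl , sym (+-identityʳ a) , refl , +-suc a s
range-split {a} (x ∷ xs) (suc s) eq with range-split xs s (proj₂ (∷-injective eq))
... | s₁ , s₂ , xs≡ , y≡ , ys≡ , bound =
  suc s₁ , s₂ , cong₂ _∷_ (proj₁ (∷-injective eq)) xs≡ , trans y≡ (sym (+-suc a s₁)) , ys≡ ,
  trans (+-suc a s) bound

inorder≡range⇒BST : ∀ t s → inorder t ≡ range a s → BST a (a + s) t
inorder≡range⇒BST {a} leaf zero _ = subst (λ b → BST a b leaf) (sym (+-identityʳ a)) leaf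
inorder≡range⇒BST {a} (node l k r) s eq with range-split (inorder l) s eq
... | s₁ , s₂ , l≡ , refl , r≡ , bound = subst (λ b → BST a b (node l k r)) (sym bound)
  (node (inorder≡range⇒BST l s₁ l≡) (inorder≡range⇒BST r s₂ r≡))

IsBST⇒BST : ∀ n → IsBST n t → BST 1 (suc n) t
IsBST⇒BST {t} n eq = inorder≡range⇒BST t n (trans eq (map-suc-upTo n))

BST⇒≤ : BST a b t → a ≤ b
BST⇒≤ leaf         = ≤-refl
BST⇒≤ (node tl tr) = ≤-trans (BST⇒≤ tl) (<⇒≤ (BST⇒≤ tr))

BST⇒keys : BST a b t → All (λ y → a ≤ y × y < b) (inorder t)
BST⇒keys leaf         = []
BST⇒keys (node tl tr) = ++⁺
  (All.map (λ (a≤y , y<k) → a≤y , <-trans y<k (BST⇒≤ tr)) (BST⇒keys tl))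
  ((BST⇒≤ tl , BST⇒≤ tr) ∷
    All.map (λ (k<y , y<b) → ≤-trans (BST⇒≤ tl) (<⇒≤ k<y) , y<b) (BST⇒keys tr))

lca-bounds : BST a b t → a ≤ p → p < b → a ≤ x → x < b → a ≤ lca t p x × lca t p x < b
lca-bounds leaf a≤p p<a _ _ = ⊥-elim (<⇒≱ p<a a≤p)
lca-bounds {p = p} {x = x} (node {k = k} {l = l} {r = r} tl tr) a≤p p<b a≤x x<b with side k p x
... | left p<k x<k rewrite lca-node-< {l = l} {r = r} p<k x<k =
  let a≤c , c<k = lca-bounds tl a≤p p<k a≤x x<k in a≤c , <-trans c<k (BST⇒≤ tr)
... | right k<p k<x rewrite lca-node-> {l = l} {r = r} k<p k<x =
  let k<c , c<b = lca-bounds tr k<p p<b k<x x<b in ≤-trans (BST⇒≤ tl) (<⇒≤ k<c) , c<b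
... | across lca≡k rewrite lca≡k {l} {r} = BST⇒≤ tl , BST⇒≤ tr

dist-node-< : BST a b (node l k r) → a ≤ p → p < k → a ≤ x → x < k →
  dist (node l k r) p x ≡ dist l p x
dist-node-< {l = l} {r = r} {p = p} {x = x} (node tl _) a≤p p<k a≤x x<k
  rewrite lca-node-< {l = l} {r = r} p<k x<k
        | depth-node-< {l = l} {r = r} p<k | depth-node-< {l = l} {r = r} x<k
        | depth-node-< {l = l} {r = r} (proj₂ (lca-bounds tl a≤p p<k a≤x x<k)) =
  cong₂ _∸_ (cong suc (+-suc (depth l p) (depth l x))) (*-suc 2 (depth l (lca l p x)))

dist-node-> : BST a b (node l k r) → k < p → p < b → k < x → x < b →
  dist (node l k r) p x ≡ dist r p x
dist-node-> {l = l} {r = r} {p = p} {x = x} (node _ tr) k<p p<b k<x x<b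
  rewrite lca-node-> {l = l} {r = r} k<p k<x
        | depth-node-> {l = l} {r = r} k<p | depth-node-> {l = l} {r = r} k<x
        | depth-node-> {l = l} {r = r} (proj₁ (lca-bounds tr k<p p<b k<x x<b)) =
  cong₂ _∸_ (cong suc (+-suc (depth r p) (depth r x))) (*-suc 2 (depth r (lca r p x)))

-- Lazy finger versus root finger

dist≤depth+depth : ∀ t p x → dist t p x ≤ depth t p + depth t x
dist≤depth+depth t p x = m∸n≤m (depth t p + depth t x) (2 * depth t (lca t p x))

lazyFrom≤depth+2*Rr : ∀ t p X → lazyFrom t p X ≤ depth t p + 2 * Rr t X
lazyFrom≤depth+2*Rr t p []      = z≤n
lazyFrom≤depth+2*Rr t p (x ∷ X) = begin
  dist t p x + lazyFrom t x X
    ≤⟨ +-mono-≤ (dist≤depth+depth t p x) (lazyFrom≤depth+2*Rr t x X) ⟩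
  (depth t p + depth t x) + (depth t x + 2 * Rr t X)
    ≡⟨ solve 3 (λ u v w → (u :+ v) :+ (v :+ con 2 :* w) := u :+ con 2 :* (v :+ w))
               refl (depth t p) (depth t x) (Rr t X) ⟩
  depth t p + 2 * (depth t x + Rr t X) ∎
  where open ≤-Reasoning

depth-rootKey : ∀ t → depth t (rootKey t) ≡ 0
depth-rootKey leaf         = refl
depth-rootKey (node l k r) = depth-node-root {l} {k} {r}

Rℓ≤2*Rr : ∀ t X → Rℓ t X ≤ 2 * Rr t X
Rℓ≤2*Rr t X =
  subst (λ d → Rℓ t X ≤ d + 2 * Rr t X) (depth-rootKey t) (lazyFrom≤depth+2*Rr t (rootKey t) X)

-- Simulating the lazy finger with rotations

Finger : Set
Finger = Ctx × Tree

private variable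
  c : Ctx
  m n y : ℕ
  u v : Tree
  f g h : Finger
  X : List ℕ

find : Ctx → Tree → ℕ → Finger
find c leaf         x = c , leaf
find c (node l k r) x =
  if x <ᵇ k then find (leftOf c k r) l x
  else if k <ᵇ x then find (rightOf l k c) r x
  else (c , node l k r)

find-node-< : x < k → find c (node l k r) x ≡ find (leftOf c k r) l x
find-node-< x<k rewrite <⇒<ᵇ≡true x<k = refl

find-node-> : k < x → find c (node l k r) x ≡ find (rightOf l k c) r x
find-node-> k<x rewrite ≤⇒<ᵇ≡false (<⇒≤ k<x) | <⇒<ᵇ≡true k<x = refl

find-node-root : find c (node l k r) k ≡ (c , node l k r)
find-node-root {k = k} rewrite ≤⇒<ᵇ≡false (≤-refl {k}) = refl

data Move : Finger → Finger → Set where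
  down-left  : Move (c , node (node u y v) x r) (leftOf c x r , node u y v)
  down-right : Move (c , node l x (node u y v)) (rightOf l x c , node u y v)
  up-left    : Move (leftOf c y r , node u x v) (c , node (node u x v) y r)
  up-right   : Move (rightOf l y c , node u x v) (c , node l y (node u x v))

Move-reverse : Move f g → Move g f
Move-reverse down-left  = up-left
Move-reverse down-right = up-right
Move-reverse up-left    = down-left
Move-reverse up-right   = down-right

data Walk : Finger → Finger → ℕ → Set where
  ε   : Walk f f 0
  _◅_ : Move f g → Walk g h n → Walk f h (suc n)

_◅◅_ : Walk f g m → Walk g h n → Walk f h (m + n)
ε       ◅◅ w′ = w′
(s ◅ w) ◅◅ w′ = s ◅ (w ◅◅ w′)

_▻_ : Walk f g n → Move g h → Walk f h (suc n)
ε       ▻ s′ = s′ ◅ ε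
(s ◅ w) ▻ s′ = s ◅ (w ▻ s′)

Walk-reverse : Walk f g n → Walk g f n
Walk-reverse ε       = ε
Walk-reverse (s ◅ w) = Walk-reverse w ▻ Move-reverse s

data IsNode : Tree → Set where
  node : IsNode (node l k r)

BST⇒IsNode : BST a b t → a ≤ x → x < b → IsNode t
BST⇒IsNode leaf       a≤x x<a = ⊥-elim (<⇒≱ x<a a≤x)
BST⇒IsNode (node _ _) _   _   = node

descend : BST a b t → a ≤ x → x < b → ∀ c → Walk (c , t) (find c t x) (depth t x)
descend leaf a≤x x<a = ⊥-elim (<⇒≱ x<a a≤x)
descend {x = x} (node {k = k} {l = l} {r = r} tl tr) a≤x x<b c with <-cmp x k
... | tri< x<k _ _
  rewrite find-node-< {c = c} {l = l} {r = r} x<k | depth-node-< {l = l} {r = r} x<k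
  with BST⇒IsNode tl a≤x x<k
...   | node = down-left ◅ descend tl a≤x x<k (leftOf c k r)
descend {x = x} (node {l = l} {r = r} tl tr) a≤x x<b c | tri≈ _ refl _
  rewrite find-node-root {c = c} {l = l} {k = x} {r = r} | depth-node-root {l = l} {k = x} {r = r} = ε
descend {x = x} (node {k = k} {l = l} {r = r} tl tr) a≤x x<b c | tri> _ _ k<x
  rewrite find-node-> {c = c} {l = l} {r = r} k<x | depth-node-> {l = l} {r = r} k<x
  with BST⇒IsNode tr k<x x<b
...   | node = down-right ◅ descend tr k<x x<b (rightOf l k c)

walk : BST a b t → a ≤ p → p < b → a ≤ x → x < b → ∀ c →
  Walk (find c t p) (find c t x) (dist t p x)
walk leaf a≤p p<a _ _ = ⊥-elim (<⇒≱ p<a a≤p)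
walk {p = p} {x = x} tb@(node {k = k} {l = l} {r = r} tl tr) a≤p p<b a≤x x<b c with side k p x
... | left p<k x<k
  rewrite find-node-< {c = c} {l = l} {r = r} p<k | find-node-< {c = c} {l = l} {r = r} x<k
        | dist-node-< tb a≤p p<k a≤x x<k = walk tl a≤p p<k a≤x x<k (leftOf c k r)
... | right k<p k<x
  rewrite find-node-> {c = c} {l = l} {r = r} k<p | find-node-> {c = c} {l = l} {r = r} k<x
        | dist-node-> tb k<p p<b k<x x<b = walk tr k<p p<b k<x x<b (rightOf l k c)
... | across lca≡k = subst (Walk _ _) (sym (dist-node-across {l = l} {r = r} (lca≡k {l} {r})))
  (Walk-reverse (descend tb a≤p p<b c) ◅◅ descend tb a≤x x<b c)

data Focused (x : ℕ) : Finger → Set where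
  focused : Focused x (c , node l x r)

find-focused : BST a b t → a ≤ x → x < b → ∀ c → Focused x (find c t x)
find-focused leaf a≤x x<a = ⊥-elim (<⇒≱ x<a a≤x)
find-focused {x = x} (node {k = k} {l = l} {r = r} tl tr) a≤x x<b c with <-cmp x k
... | tri< x<k _ _ rewrite find-node-< {c = c} {l = l} {r = r} x<k =
  find-focused tl a≤x x<k (leftOf c k r)
... | tri≈ _ refl _ rewrite find-node-root {c = c} {l = l} {k = x} {r = r} = focused
... | tri> _ _ k<x rewrite find-node-> {c = c} {l = l} {r = r} k<x =
  find-focused tr k<x x<b (rightOf l k c)

smaller : Ctx → Tree → Tree
smaller top             t = t
smaller (leftOf c _ _)  t = smaller c t
smaller (rightOf l y c) t = node (smaller c l) y t

larger : Ctx → Tree → Tree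
larger top             t = t
larger (rightOf _ _ c) t = larger c t
larger (leftOf c y r)  t = node t y (larger c r)

-- The tree of the finger with the finger's node rotated up to the root.
rerooted : Finger → Tree
rerooted (c , leaf)       = leaf
rerooted (c , node l x r) = node (smaller c l) x (larger c r)

smaller-shape : ∀ c →
  (∀ t → smaller c t ≡ t) ⊎ Σ[ u ∈ Tree ] Σ[ y ∈ ℕ ] (∀ t → smaller c t ≡ node u y t)
smaller-shape top             = inj₁ λ _ → refl
smaller-shape (leftOf c _ _)  = smaller-shape c
smaller-shape (rightOf l y c) = inj₂ (smaller c l , y , λ _ → refl)

larger-shape : ∀ c →
  (∀ t → larger c t ≡ t) ⊎ Σ[ u ∈ Tree ] Σ[ y ∈ ℕ ] (∀ t → larger c t ≡ node t y u)
larger-shape top             = inj₁ λ _ → refl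
larger-shape (rightOf _ _ c) = larger-shape c
larger-shape (leftOf c y r)  = inj₂ (larger c r , y , λ _ → refl)

_++ˢ_ : ∀ {c t c′ t′ c″ t″} →
  Steps c t c′ t′ m → Steps c′ t′ c″ t″ n → Steps c t c″ t″ (m + n)
done      ++ˢ ss′ = ss′
more s ss ++ˢ ss′ = more s (ss ++ˢ ss′)

AtMost6 : Tree → Tree → Set
AtMost6 t t′ = Σ[ n ∈ ℕ ] Steps top t top t′ n × n ≤ 6

atMost6 : ∀ {t t′} → Steps top t top t′ n → {T (n ≤ᵇ 6)} → AtMost6 t t′
atMost6 {n} ss {n≤6} = n , ss , ≤ᵇ⇒≤ n 6 n≤6

simulate-move : Move f g → AtMost6 (rerooted f) (rerooted g)
simulate-move (down-left {c = c} {u = u} {y = y} {v = v}) with smaller-shape c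
... | inj₁ eq rewrite eq (node u y v) | eq u = atMost6 (more goLeft (more rotL done))
... | inj₂ (_ , _ , eq) rewrite eq (node u y v) | eq u =
  atMost6 (more goLeft (more goRight (more rotR (more rotL done))))
simulate-move (down-right {c = c} {u = u} {y = y} {v = v}) with larger-shape c
... | inj₁ eq rewrite eq (node u y v) | eq v = atMost6 (more goRight (more rotR done))
... | inj₂ (_ , _ , eq) rewrite eq (node u y v) | eq v =
  atMost6 (more goRight (more goLeft (more rotL (more rotR done))))
simulate-move (up-left {c = c} {u = u} {x = x} {v = v}) with smaller-shape c
... | inj₁ eq rewrite eq (node u x v) | eq u = atMost6 (more goRight (more rotR done))
... | inj₂ (_ , _ , eq) rewrite eq (node u x v) | eq u =
  atMost6 (more goRight (more rotR (more goLeft (more goLeft (more rotL (more goUpL done))))))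
simulate-move (up-right {c = c} {u = u} {x = x} {v = v}) with larger-shape c
... | inj₁ eq rewrite eq (node u x v) | eq v = atMost6 (more goLeft (more rotL done))
... | inj₂ (_ , _ , eq) rewrite eq (node u x v) | eq v =
  atMost6 (more goLeft (more rotL (more goRight (more goRight (more rotR (more goUpR done))))))

simulate-walk : Walk f g n → Σ[ m ∈ ℕ ] Steps top (rerooted f) top (rerooted g) m × m ≤ 6 * n
simulate-walk ε = 0 , done , z≤n
simulate-walk {n = suc n} (s ◅ w) with simulate-move s | simulate-walk w
... | m₁ , ss₁ , m₁≤6 | m₂ , ss₂ , m₂≤6n =
  m₁ + m₂ , ss₁ ++ˢ ss₂ , subst (m₁ + m₂ ≤_) (sym (*-suc 6 n)) (+-mono-≤ m₁≤6 m₂≤6n)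

search-rerooted : ∀ {t} → Steps top t top (rerooted f) n → Focused x f → Search t x (rerooted f) n
search-rerooted {n = n} ss focused = search ss done refl (+-identityʳ n)

rerooted-executes≤6*lazyFrom : BST a b t → All (λ x → a ≤ x × x < b) X → a ≤ p → p < b →
  Σ[ n ∈ ℕ ] Executes (rerooted (find top t p)) X n × n ≤ 6 * lazyFrom t p X
rerooted-executes≤6*lazyFrom tb [] a≤p p<b = 0 , finish , z≤n
rerooted-executes≤6*lazyFrom {t = t} {p = p} tb ((a≤x , x<b) ∷ keys) a≤p p<b
  with simulate-walk (walk tb a≤p p<b a≤x x<b top) | rerooted-executes≤6*lazyFrom tb keys a≤x x<b
... | m₁ , ss , m₁≤ | m₂ , exec , m₂≤ =
  m₁ + m₂ , next (search-rerooted ss (find-focused tb a≤x x<b top)) exec ,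
  subst (m₁ + m₂ ≤_) (sym (*-distribˡ-+ 6 (dist t p _) _)) (+-mono-≤ m₁≤ m₂≤)

executes≤6*Rℓ : BST a b t → All (λ x → a ≤ x × x < b) X →
  Σ[ n ∈ ℕ ] Executes t X n × n ≤ 6 * Rℓ t X
executes≤6*Rℓ tb                  []                  = 0 , finish , z≤n
executes≤6*Rℓ leaf                ((a≤x , x<a) ∷ _) = ⊥-elim (<⇒≱ x<a a≤x)
executes≤6*Rℓ {t = node l k r} tb@(node tl tr) keys@(_ ∷ _)
  with rerooted-executes≤6*lazyFrom tb keys (BST⇒≤ tl) (BST⇒≤ tr)
... | result rewrite find-node-root {c = top} {l = l} {k = k} {r = r} = result

-- Two blocks of searches

j+j≤m⇒j≤⌊m/2⌋ : ∀ {j m} → j + j ≤ m → j ≤ ⌊ m /2⌋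
j+j≤m⇒j≤⌊m/2⌋ {j} j+j≤m = subst (_≤ _) (sym (n≡⌊n+n/2⌋ j)) (⌊n/2⌋-mono j+j≤m)

Rr-++ : ∀ t xs ys → Rr t (xs ++ ys) ≡ Rr t xs + Rr t ys
Rr-++ t xs ys = trans (cong sum (map-++ (depth t) xs ys)) (sum-++ (map (depth t) xs) (map (depth t) ys))

Rr-replicate : ∀ t n x → Rr t (replicate n x) ≡ n * depth t x
Rr-replicate t zero    x = refl
Rr-replicate t (suc n) x = cong (depth t x +_) (Rr-replicate t n x)

lazyFrom-replicate : ∀ t n x ys → dist t x x ≡ 0 →
  lazyFrom t x (replicate n x ++ ys) ≡ lazyFrom t x ys
lazyFrom-replicate t zero    x ys _    = refl
lazyFrom-replicate t (suc n) x ys d≡0 rewrite d≡0 = lazyFrom-replicate t n x ys d≡0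

twoBlocks : ℕ → List ℕ
twoBlocks m = replicate ⌊ m /2⌋ 1 ++ replicate ⌈ m /2⌉ 2

twoBlocks-family : SeqFamily
twoBlocks-family = record
  { size  = λ _ → 2
  ; seq   = twoBlocks
  ; len   = λ m → begin
      length (twoBlocks m)
        ≡⟨ length-++ (replicate ⌊ m /2⌋ 1) ⟩
      length (replicate ⌊ m /2⌋ 1) + length (replicate ⌈ m /2⌉ 2)
        ≡⟨ cong₂ _+_ (length-replicate ⌊ m /2⌋) (length-replicate ⌈ m /2⌉) ⟩
      ⌊ m /2⌋ + ⌈ m /2⌉
        ≡⟨ ⌊n/2⌋+⌈n/2⌉≡n m ⟩
      m ∎
  ; valid = λ m → ++⁺ (replicate⁺ ⌊ m /2⌋ (s≤s z≤n , s≤s z≤n))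
                      (replicate⁺ ⌈ m /2⌉ (s≤s z≤n , s≤s (s≤s z≤n)))
  }
  where open ≡-Reasoning

tree₁₂ : Tree
tree₁₂ = node leaf 1 (node leaf 2 leaf)

Rℓ-tree₁₂-twoBlocks≤1 : ∀ m → Rℓ tree₁₂ (twoBlocks m) ≤ 1
Rℓ-tree₁₂-twoBlocks≤1 m
  rewrite lazyFrom-replicate tree₁₂ ⌊ m /2⌋ 1 (replicate ⌈ m /2⌉ 2) refl with ⌈ m /2⌉
... | zero  = z≤n
... | suc n = ≤-reflexive (cong suc (begin
  lazyFrom tree₁₂ 2 (replicate n 2)       ≡⟨ cong (lazyFrom tree₁₂ 2) (sym (++-identityʳ (replicate n 2))) ⟩
  lazyFrom tree₁₂ 2 (replicate n 2 ++ []) ≡⟨ lazyFrom-replicate tree₁₂ n 2 [] refl ⟩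
  0                                       ∎))
  where open ≡-Reasoning

⌊m/2⌋≤Rr-twoBlocks : ∀ t → IsBST 2 t → ∀ m → ⌊ m /2⌋ ≤ Rr t (twoBlocks m)
⌊m/2⌋≤Rr-twoBlocks (node l k r) _ m
  rewrite Rr-++ (node l k r) (replicate ⌊ m /2⌋ 1) (replicate ⌈ m /2⌉ 2)
        | Rr-replicate (node l k r) ⌊ m /2⌋ 1 | Rr-replicate (node l k r) ⌈ m /2⌉ 2
  with depth (node l k r) 1 in d₁ | depth (node l k r) 2 in d₂
... | zero  | zero
  with () ← trans (depth≡0⇒root {l} {k} {r} d₁) (sym (depth≡0⇒root {l} {k} {r} d₂))
... | suc e | _     = ≤-trans (m≤m*n ⌊ m /2⌋ (suc e)) (m≤m+n _ _)
... | zero  | suc e = ≤-trans (⌊n/2⌋≤⌈n/2⌉ m) (≤-trans (m≤m*n ⌈ m /2⌉ (suc e)) (m≤n+m _ _))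

c*Rℓ-tree₁₂<Rr-twoBlocks : ∀ c m → suc c + suc c ≤ m →
  ∀ t → IsBST 2 t → c * Rℓ tree₁₂ (twoBlocks m) < Rr t (twoBlocks m)
c*Rℓ-tree₁₂<Rr-twoBlocks c m 2+2c≤m t isBST = begin-strict
  c * Rℓ tree₁₂ (twoBlocks m) ≤⟨ *-monoʳ-≤ c (Rℓ-tree₁₂-twoBlocks≤1 m) ⟩
  c * 1                       ≡⟨ *-identityʳ c ⟩
  c                           <⟨ j+j≤m⇒j≤⌊m/2⌋ 2+2c≤m ⟩
  ⌊ m /2⌋                     ≤⟨ ⌊m/2⌋≤Rr-twoBlocks t isBST m ⟩
  Rr t (twoBlocks m)          ∎
  where open ≤-Reasoning

-- Few keys lie near a given key

count : ∀ {A : Set} → (A → Bool) → List A → ℕ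
count P []       = 0
count P (x ∷ xs) = (if P x then 1 else 0) + count P xs

module _ {A : Set} where

  count-++ : ∀ (P : A → Bool) xs ys → count P (xs ++ ys) ≡ count P xs + count P ys
  count-++ P []       ys = refl
  count-++ P (x ∷ xs) ys =
    trans (cong (bit +_) (count-++ P xs ys)) (sym (+-assoc bit (count P xs) (count P ys)))
    where bit = if P x then 1 else 0

  count-cong : ∀ {P Q : A → Bool} {xs} → All (λ y → P y ≡ Q y) xs → count P xs ≡ count Q xs
  count-cong []           = refl
  count-cong (P≡Q ∷ eqs) = cong₂ _+_ (cong (λ β → if β then 1 else 0) P≡Q) (count-cong eqs)

  count-none : ∀ {P : A → Bool} {xs} → All (λ y → P y ≡ false) xs → count P xs ≡ 0
  count-none []             = refl
  count-none (P≡false ∷ ps) rewrite P≡false = count-none ps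

  D*length≤sum+D*count : ∀ (f : A → ℕ) D xs →
    D * length xs ≤ sum (map f xs) + D * count (λ y → f y <ᵇ D) xs
  D*length≤sum+D*count f D []       = ≤-reflexive (trans (*-zeroʳ D) (sym (*-zeroʳ D)))
  D*length≤sum+D*count f D (x ∷ xs) with f x <ᵇ D in fx<D
  ... | true  = begin
    D * suc (length xs)     ≡⟨ *-suc D _ ⟩
    D + D * length xs       ≤⟨ +-mono-≤ (m≤n+m D (f x)) (D*length≤sum+D*count f D xs) ⟩
    (f x + D) + (S + D * C) ≡⟨ solve 4 (λ u v w d → (u :+ d) :+ (v :+ d :* w)
                                                 := u :+ v :+ d :* (con 1 :+ w)) refl (f x) S C D ⟩
    f x + S + D * (1 + C)   ∎
    where open ≤-Reasoning
          S = sum (map f xs)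
          C = count (λ y → f y <ᵇ D) xs
  ... | false = begin
    D * suc (length xs) ≡⟨ *-suc D _ ⟩
    D + D * length xs   ≤⟨ +-mono-≤ (<ᵇ≡false⇒≥ fx<D) (D*length≤sum+D*count f D xs) ⟩
    f x + (S + D * C)   ≡⟨ sym (+-assoc (f x) S (D * C)) ⟩
    f x + S + D * C     ∎
    where open ≤-Reasoning
          S = sum (map f xs)
          C = count (λ y → f y <ᵇ D) xs

count-range-prefix : ∀ (P : ℕ → Bool) a s → count P (range a s) ≤ count P (range a (suc s))
count-range-prefix P a zero    = z≤n
count-range-prefix P a (suc s) = +-monoʳ-≤ (if P a then 1 else 0) (count-range-prefix P (suc a) s)

2^[1+n]≡2^n+2^n : ∀ n → 2 ^ suc n ≡ 2 ^ n + 2 ^ n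
2^[1+n]≡2^n+2^n n = cong (2 ^ n +_) (+-identityʳ (2 ^ n))

count-depth<-<2^ : BST a b t → ∀ E → count (λ y → depth t y <ᵇ E) (inorder t) < 2 ^ E
count-depth<-<2^ leaf E = m^n>0 2 E
count-depth<-<2^ {t = t} (node _ _) zero =
  ≤-reflexive (cong suc (count-none {xs = inorder t} (All.tabulate (λ _ → refl))))
count-depth<-<2^ {t = node l k r} (node tl tr) (suc E) = begin-strict
  count (depth< (suc E)) (inorder l ++ k ∷ inorder r)
    ≡⟨ count-++ _ (inorder l) (k ∷ inorder r) ⟩
  count (depth< (suc E)) (inorder l) + count (depth< (suc E)) (k ∷ inorder r)
    ≡⟨ cong₂ _+_
         (count-cong (All.map (λ (_ , y<k) → cong (_<ᵇ suc E) (depth-node-< {l = l} {r = r} y<k))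
                              (BST⇒keys tl)))
         (cong₂ _+_ (cong (λ d → if d <ᵇ suc E then 1 else 0) (depth-node-root {l} {k} {r}))
                    (count-cong (All.map (λ (k<y , _) → cong (_<ᵇ suc E) (depth-node-> {l = l} {r = r} k<y))
                                         (BST⇒keys tr)))) ⟩
  count (λ y → depth l y <ᵇ E) (inorder l) + suc (count (λ y → depth r y <ᵇ E) (inorder r))
    <⟨ +-mono-≤ (count-depth<-<2^ tl E) (count-depth<-<2^ tr E) ⟩
  2 ^ E + 2 ^ E
    ≡⟨ sym (2^[1+n]≡2^n+2^n E) ⟩
  2 ^ suc E ∎
  where open ≤-Reasoning
        depth< : ℕ → ℕ → Bool
        depth< E y = depth (node l k r) y <ᵇ E

+-cancelˡ-<ᵇ : ∀ n x y → (n + x <ᵇ n + y) ≡ (x <ᵇ y)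
+-cancelˡ-<ᵇ zero    x y = refl
+-cancelˡ-<ᵇ (suc n) x y = +-cancelˡ-<ᵇ n x y

count-shifted+2^≤2^ : ∀ (g : ℕ → ℕ) xs e D → (∀ E → count (λ y → g y <ᵇ E) xs < 2 ^ E) →
  count (λ y → suc e + g y <ᵇ D) xs + 2 ^ (D ∸ suc e) ≤ 2 ^ (D ∸ e)
count-shifted+2^≤2^ g xs e D g-bound with ≤-total (suc e) D
... | inj₂ D≤1+e
  rewrite count-none {P = λ y → suc e + g y <ᵇ D} {xs}
            (All.tabulate λ {y} _ → ≤⇒<ᵇ≡false (≤-trans D≤1+e (m≤m+n (suc e) (g y))))
  = ^-monoʳ-≤ 2 (∸-monoʳ-≤ D (n≤1+n e))
... | inj₁ 1+e≤D with j , refl ← m≤n⇒∃[o]m+o≡n 1+e≤D = begin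
  count (λ y → suc e + g y <ᵇ suc e + j) xs + 2 ^ (suc e + j ∸ suc e)
    ≡⟨ cong₂ _+_ (count-cong {xs = xs} (All.tabulate λ {y} _ → +-cancelˡ-<ᵇ (suc e) (g y) j))
                 (cong (2 ^_) (m+n∸m≡n (suc e) j)) ⟩
  count (λ y → g y <ᵇ j) xs + 2 ^ j
    ≤⟨ +-monoˡ-≤ (2 ^ j) (<⇒≤ (g-bound j)) ⟩
  2 ^ j + 2 ^ j
    ≡⟨ sym (2^[1+n]≡2^n+2^n j) ⟩
  2 ^ suc j
    ≡⟨ cong (2 ^_) (sym (trans (cong (_∸ e) (sym (+-suc e j))) (m+n∸m≡n e (suc j)))) ⟩
  2 ^ (suc e + j ∸ e) ∎
  where open ≤-Reasoning

ball : Tree → ℕ → ℕ → ℕ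
ball t z D = count (λ y → dist t z y <ᵇ D) (inorder t)

ball-node-< : ∀ {z D} → BST a b (node l k r) → a ≤ z → z < k →
  ball (node l k r) z D ≡
  ball l z D + count (λ y → suc (depth l z) + depth (node leaf k r) y <ᵇ D) (inorder (node leaf k r))
ball-node-< {l = l} {k = k} {r = r} {z = z} {D = D} tb@(node tl tr) a≤z z<k =
  trans (count-++ _ (inorder l) (k ∷ inorder r)) (cong₂ _+_
    (count-cong (All.map (λ (a≤y , y<k) → cong (_<ᵇ D) (dist-node-< tb a≤z z<k a≤y y<k))
                         (BST⇒keys tl)))
    (count-cong (All.map (λ (k≤y , _) → cong (_<ᵇ D) (dist≡ k≤y)) (BST⇒keys (node leaf tr)))))
  where
  dist≡ : ∀ {y} → k ≤ y → dist (node l k r) z y ≡ suc (depth l z) + depth (node leaf k r) y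
  dist≡ k≤y = trans (dist-node-across {l = l} {r = r} (lca-node-≤≤ {l = l} {r = r} (<⇒≤ z<k) k≤y))
    (cong₂ _+_ (depth-node-< {l = l} {r = r} z<k) (depth-node-≥ {l = l} {r = r} {u = leaf} k≤y))

ball-node-> : ∀ {z D} → BST a b (node l k r) → k < z → z < b →
  ball (node l k r) z D ≡
  count (λ y → suc (depth r z) + depth (node l k leaf) y <ᵇ D) (inorder (node l k leaf)) + ball r z D
ball-node-> {l = l} {k = k} {r = r} {z = z} {D = D} tb@(node tl tr) k<z z<b =
  trans (cong (count _) (sym (++-assoc (inorder l) (k ∷ []) (inorder r))))
  (trans (count-++ _ (inorder (node l k leaf)) (inorder r)) (cong₂ _+_
    (count-cong (All.map (λ (_ , y<1+k) → cong (_<ᵇ D) (dist≡ (≤-pred y<1+k)))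
                         (BST⇒keys (node tl leaf))))
    (count-cong (All.map (λ (k<y , y<b) → cong (_<ᵇ D) (dist-node-> tb k<z z<b k<y y<b))
                         (BST⇒keys tr)))))
  where
  dist≡ : ∀ {y} → y ≤ k → dist (node l k r) z y ≡ suc (depth r z) + depth (node l k leaf) y
  dist≡ y≤k = trans (dist-node-across {l = l} {r = r} (lca-node-≥≥ {l = l} {r = r} (<⇒≤ k<z) y≤k))
    (cong₂ _+_ (depth-node-> {l = l} {r = r} k<z) (depth-node-≤ {l = l} {r = r} {u = leaf} y≤k))

-- The term 2 ^ (D ∸ depth t z) is room reserved for the part of the ball that leaves t through
-- its root; in the parent it pays for the parent itself and the sibling subtree.
ball+2^≤2^ : ∀ {z} → BST a b t → a ≤ z → z < b → ∀ D →
  ball t z D + 2 ^ (D ∸ depth t z) ≤ 2 ^ suc D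
ball+2^≤2^ leaf a≤z z<a = ⊥-elim (<⇒≱ z<a a≤z)
ball+2^≤2^ {t = node l k r} {z = z} tb@(node tl tr) a≤z z<b D with <-cmp z k
... | tri< z<k _ _ = begin
  ball (node l k r) z D + 2 ^ (D ∸ depth (node l k r) z)
    ≡⟨ cong₂ _+_ (ball-node-< {D = D} tb a≤z z<k)
                 (cong (λ d → 2 ^ (D ∸ d)) (depth-node-< {l = l} {r = r} z<k)) ⟩
  ball l z D + F + 2 ^ (D ∸ suc (depth l z))
    ≡⟨ +-assoc (ball l z D) F _ ⟩
  ball l z D + (F + 2 ^ (D ∸ suc (depth l z)))
    ≤⟨ +-monoʳ-≤ (ball l z D) (count-shifted+2^≤2^ (depth (node leaf k r)) (inorder (node leaf k r))
                                                     (depth l z) D (count-depth<-<2^ (node leaf tr))) ⟩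
  ball l z D + 2 ^ (D ∸ depth l z)
    ≤⟨ ball+2^≤2^ tl a≤z z<k D ⟩
  2 ^ suc D ∎
  where open ≤-Reasoning
        F = count (λ y → suc (depth l z) + depth (node leaf k r) y <ᵇ D) (inorder (node leaf k r))
... | tri> _ _ k<z = begin
  ball (node l k r) z D + 2 ^ (D ∸ depth (node l k r) z)
    ≡⟨ cong₂ _+_ (ball-node-> {D = D} tb k<z z<b)
                 (cong (λ d → 2 ^ (D ∸ d)) (depth-node-> {l = l} {r = r} k<z)) ⟩
  F + ball r z D + 2 ^ (D ∸ suc (depth r z))
    ≡⟨ solve 3 (λ u v w → u :+ v :+ w := v :+ (u :+ w)) refl F (ball r z D) _ ⟩
  ball r z D + (F + 2 ^ (D ∸ suc (depth r z)))
    ≤⟨ +-monoʳ-≤ (ball r z D) (count-shifted+2^≤2^ (depth (node l k leaf)) (inorder (node l k leaf))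
                                                     (depth r z) D (count-depth<-<2^ (node tl leaf))) ⟩
  ball r z D + 2 ^ (D ∸ depth r z)
    ≤⟨ ball+2^≤2^ tr k<z z<b D ⟩
  2 ^ suc D ∎
  where open ≤-Reasoning
        F = count (λ y → suc (depth r z) + depth (node l k leaf) y <ᵇ D) (inorder (node l k leaf))
... | tri≈ _ refl _ = begin
  ball (node l z r) z D + 2 ^ (D ∸ depth (node l z r) z)
    ≡⟨ cong₂ _+_ (count-cong {xs = inorder (node l z r)} (All.tabulate λ _ → cong (_<ᵇ D) dist≡depth))
                 (cong (λ d → 2 ^ (D ∸ d)) (depth-node-root {l} {z} {r})) ⟩
  count (λ y → depth (node l z r) y <ᵇ D) (inorder (node l z r)) + 2 ^ D
    ≤⟨ +-monoˡ-≤ (2 ^ D) (<⇒≤ (count-depth<-<2^ tb D)) ⟩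
  2 ^ D + 2 ^ D
    ≡⟨ sym (2^[1+n]≡2^n+2^n D) ⟩
  2 ^ suc D ∎
  where open ≤-Reasoning
        dist≡depth : ∀ {y} → dist (node l z r) z y ≡ depth (node l z r) y
        dist≡depth {y} = trans (dist-node-across {l = l} {r = r} (lca-node-root {l} {z} {r}))
                               (cong (_+ depth (node l z r) y) (depth-node-root {l} {z} {r}))

ball<2^ : ∀ {z} → BST a b t → a ≤ z → z < b → ∀ D → ball t z D < 2 ^ suc D
ball<2^ {t = t} {z = z} tb a≤z z<b D =
  <-≤-trans (m<m+n (ball t z D) (m^n>0 2 (D ∸ depth t z))) (ball+2^≤2^ tb a≤z z<b D)

-- The hub sequence 1, 2, 1, 3, 1, 4, …

hubSequence : ℕ → ℕ → List ℕ
hubSequence y zero          = []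
hubSequence y (suc zero)    = 1 ∷ []
hubSequence y (suc (suc m)) = 1 ∷ y ∷ hubSequence (suc y) m

length-hubSequence : ∀ y m → length (hubSequence y m) ≡ m
length-hubSequence y zero          = refl
length-hubSequence y (suc zero)    = refl
length-hubSequence y (suc (suc m)) = cong (suc ∘ suc) (length-hubSequence (suc y) m)

hubSequence-valid : ∀ y m → 1 ≤ y → 1 ≤ n → y + ⌊ m /2⌋ ≤ suc n → ValidSeq n (hubSequence y m)
hubSequence-valid     y zero          _   _   _     = []
hubSequence-valid     y (suc zero)    _   1≤n _     = (≤-refl , 1≤n) ∷ []
hubSequence-valid {n} y (suc (suc m)) 1≤y 1≤n bound =
  (≤-refl , 1≤n) ∷ (1≤y , ≤-trans (m≤m+n y ⌊ m /2⌋) (≤-pred bound′)) ∷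
  hubSequence-valid (suc y) m z<s 1≤n bound′
  where bound′ = subst (_≤ suc n) (+-suc y ⌊ m /2⌋) bound

hub-family : SeqFamily
hub-family = record
  { size  = λ m → 2 + ⌊ m /2⌋
  ; seq   = hubSequence 2
  ; len   = length-hubSequence 2
  ; valid = λ m → hubSequence-valid 2 m z<s z<s (n≤1+n _)
  }

spine : ℕ → ℕ → Tree
spine a zero    = leaf
spine a (suc j) = node leaf a (spine (suc a) j)

IsBST-spine : ∀ n → IsBST n (spine 1 n)
IsBST-spine n = trans (inorder-spine 1 n) (sym (map-suc-upTo n))
  where
  inorder-spine : ∀ a j → inorder (spine a j) ≡ range a j
  inorder-spine a zero    = refl
  inorder-spine a (suc j) = cong (a ∷_) (inorder-spine (suc a) j)

-- Keys: 1 < keys of u < y < y + 1 < ….  Searching 1 costs nothing, reaching y costs one move,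
-- and one more move and a rotation put y + 1 in y's place with y as its left child, which is
-- the same shape for the next round.
hubTree : Tree → ℕ → ℕ → Tree
hubTree u y j = node leaf 1 (node u y (spine (suc y) j))

execute-hubSequence : ∀ u y j m → ⌊ m /2⌋ ≤ j →
  Σ[ n ∈ ℕ ] Executes (hubTree u y j) (hubSequence y m) n × n ≤ 3 * ⌊ m /2⌋
execute-hubSequence u y j       zero          _ = 0 , finish , z≤n
execute-hubSequence u y j       (suc zero)    _ = 0 , next (search done done refl refl) finish , z≤n
execute-hubSequence u y (suc j) (suc (suc m)) (s≤s h≤j)
  with execute-hubSequence (node u y leaf) (suc y) j m h≤j
... | n , exec , n≤3h =
  3 + n ,
  next (search done done refl refl)
       (next (search (more goRight done) (more goRight (more rotR done)) refl refl) exec) ,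
  subst (3 + n ≤_) (sym (*-suc 3 ⌊ m /2⌋)) (+-monoʳ-≤ 3 n≤3h)

sum-dist≤lazyFrom-hubSequence : ∀ t p y m →
  sum (map (dist t 1) (range y ⌊ m /2⌋)) ≤ lazyFrom t p (hubSequence y m)
sum-dist≤lazyFrom-hubSequence t p y zero          = z≤n
sum-dist≤lazyFrom-hubSequence t p y (suc zero)    = z≤n
sum-dist≤lazyFrom-hubSequence t p y (suc (suc m)) =
  ≤-trans (+-monoʳ-≤ (dist t 1 y) (sum-dist≤lazyFrom-hubSequence t y (suc y) m)) (m≤n+m _ (dist t p 1))

D*⌊m/2⌋≤Rℓ-hubSequence+D*2^[1+D] : ∀ m → IsBST (2 + ⌊ m /2⌋) t → ∀ D →
  D * ⌊ m /2⌋ ≤ Rℓ t (hubSequence 2 m) + D * 2 ^ suc D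
D*⌊m/2⌋≤Rℓ-hubSequence+D*2^[1+D] {t} m isBST D = begin
  D * half
    ≡⟨ cong (D *_) (sym (length-range 2 half)) ⟩
  D * length (range 2 half)
    ≤⟨ D*length≤sum+D*count (dist t 1) D (range 2 half) ⟩
  sum (map (dist t 1) (range 2 half)) + D * near
    ≤⟨ +-mono-≤ (sum-dist≤lazyFrom-hubSequence t (rootKey t) 2 m) (*-monoʳ-≤ D (<⇒≤ near<2^)) ⟩
  Rℓ t (hubSequence 2 m) + D * 2 ^ suc D ∎
  where
  open ≤-Reasoning
  half = ⌊ m /2⌋
  near = count (λ y → dist t 1 y <ᵇ D) (range 2 half)
  near<2^ : near < 2 ^ suc D
  near<2^ = begin-strict
    near
      ≤⟨ count-range-prefix _ 2 half ⟩
    count (λ y → dist t 1 y <ᵇ D) (range 2 (suc half))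
      ≤⟨ m≤n+m _ (if dist t 1 1 <ᵇ D then 1 else 0) ⟩
    count (λ y → dist t 1 y <ᵇ D) (range 1 (2 + half))
      ≡⟨ cong (count _) (sym (trans isBST (map-suc-upTo _))) ⟩
    ball t 1 D
      <⟨ ball<2^ {t = t} (IsBST⇒BST (2 + half) isBST) ≤-refl (s≤s z<s) D ⟩
    2 ^ suc D ∎

hubThreshold : ℕ → ℕ
hubThreshold c = H + H
  where D = suc (3 * c)
        H = suc (D * 2 ^ suc D)

c*[3*⌊m/2⌋]<Rℓ-hubSequence : ∀ c m → hubThreshold c ≤ m →
  ∀ t → IsBST (2 + ⌊ m /2⌋) t → c * (3 * ⌊ m /2⌋) < Rℓ t (hubSequence 2 m)
c*[3*⌊m/2⌋]<Rℓ-hubSequence c m threshold≤m t isBST = +-cancelʳ-< (D * 2 ^ suc D) _ _ (begin-strict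
  c * (3 * half) + D * 2 ^ suc D <⟨ +-monoʳ-< (c * (3 * half)) (j+j≤m⇒j≤⌊m/2⌋ threshold≤m) ⟩
  c * (3 * half) + half          ≡⟨ solve 2 (λ c h → c :* (con 3 :* h) :+ h := (con 1 :+ con 3 :* c) :* h)
                                             refl c half ⟩
  D * half                       ≤⟨ D*⌊m/2⌋≤Rℓ-hubSequence+D*2^[1+D] m isBST D ⟩
  Rℓ t (hubSequence 2 m) + D * 2 ^ suc D ∎)
  where
  open ≤-Reasoning
  D = suc (3 * c)
  half = ⌊ m /2⌋

theorem3 :
    (Σ[ c ∈ ℕ ] (∀ n (X : List ℕ) → ValidSeq n X →
       ∀ T → IsBST n T →
       Σ[ T' ∈ Tree ] (IsBST n T' × Rℓ T' X ≤ c * Rr T X)))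
    × (Σ[ c ∈ ℕ ] (∀ n (X : List ℕ) → ValidSeq n X →
       ∀ T → IsBST n T →
       Σ[ t₀ ∈ Tree ] (IsBST n t₀ × (Σ[ k ∈ ℕ ] (Executes t₀ X k × k ≤ c * Rℓ T X)))))
    × (Σ[ F ∈ SeqFamily ] (∀ c → Σ[ M ∈ ℕ ] (∀ m → M ≤ m →
       Σ[ T' ∈ Tree ] (IsBST (size F m) T' ×
         (∀ T → IsBST (size F m) T → c * Rℓ T' (seq F m) < Rr T (seq F m))))))
    × (Σ[ F ∈ SeqFamily ] (∀ c → Σ[ M ∈ ℕ ] (∀ m → M ≤ m →
       Σ[ t₀ ∈ Tree ] (IsBST (size F m) t₀ × (Σ[ k ∈ ℕ ] (Executes t₀ (seq F m) k ×
         (∀ T → IsBST (size F m) T → c * k < Rℓ T (seq F m))))))))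
theorem3 =
    (2 , λ n X _ T isBST → T , isBST , Rℓ≤2*Rr T X)
  , (6 , λ n X valid T isBST → T , isBST ,
       executes≤6*Rℓ (IsBST⇒BST n isBST) (All.map (λ (1≤x , x≤n) → 1≤x , s≤s x≤n) valid))
  , (twoBlocks-family , λ c → suc c + suc c , λ m M≤m →
       tree₁₂ , refl , c*Rℓ-tree₁₂<Rr-twoBlocks c m M≤m)
  , (hub-family , λ c → hubThreshold c , λ m M≤m →
       let k , exec , k≤3⌊m/2⌋ = execute-hubSequence leaf 2 ⌊ m /2⌋ m ≤-refl in
       spine 1 (2 + ⌊ m /2⌋) , IsBST-spine (2 + ⌊ m /2⌋) , k , exec ,
       λ T isBST → ≤-<-trans (*-monoʳ-≤ c k≤3⌊m/2⌋)
                             (c*[3*⌊m/2⌋]<Rℓ-hubSequence c m M≤m T isBST))
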